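{- Let $f:\mathbb{F}_{2^n}\to\mathbb{F}_{2^n}$ be APN. Then: (a) $M_1(f)+M_2(f)\geq 1$. For $n$ even, equality holds if and only if $f$ is almost-3-to-1. For $n$ odd, equality holds if and only if there is a unique element in $\mathrm{Im}(f)$ with exactly two preimages and all remaining elements of $\mathrm{Im}(f)$ have exactly three preimages. (b) $3M_1(f)+4M_2(f)+3M_3(f)\geq 2^n+2$. Equality holds if and only if $N(f)=3\cdot 2^n-2$ and $M_r(f)=0$ for all $r>4$, in which case $M_1(f)+M_2(f)=2M_4(f)+1$.
   Context: A map $f:\mathbb{F}_{2^n}\to\mathbb{F}_{2^n}$ is APN (almost perfect nonlinear) if for every $a\neq 0$ and every $b$ the equation $f(x+a)+f(x)=b$ has at most 2 solutions $x\in\mathbb{F}_{2^n}$. $M_r(f)$ is the number of elements of $\mathbb{F}_{2^n}$ with exactly $r$ preimages under $f$; $N(f)$ is the number of pairs $(x,y)\in\mathbb{F}_{2^n}^2$ with $f(x)=f(y)$. A map is almost-3-to-1 if there is a unique element of $\mathrm{Im}(f)$ with exactly one preimage and every other element of $\mathrm{Im}(f)$ has exactly 3 preimages. -}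

module Defs where

open import Data.Nat using (ℕ; zero; suc; _≤_; _*_; _+_)
open import Data.Nat.Divisibility using (_∣_)
open import Data.Bool using (Bool; true; false; _xor_)
import Data.Bool as B
open import Data.Vec using (Vec; []; _∷_; zipWith; replicate)
open import Data.Vec.Properties using (≡-dec)
open import Data.List using (List; [_]; _++_; map; filter; length; cartesianProduct)
open import Data.Product using (Σ; _×_; _,_; proj₁; proj₂; ∃)
open import Relation.Binary.PropositionalEquality using (_≡_)
open import Relation.Nullary using (¬_)
import Data.Nat as N

-- The additive group of F_{2^n}: coordinates w.r.t. an F_2-basis, addition = xor.
-- (All notions below — APN, M_r, N, almost-3-to-1 — only use addition.)
F : ℕ → Set
F n = Vec Bool n

_⊕_ : ∀ {n} → F n → F n → F n
_⊕_ = zipWith _xor_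

𝟘 : ∀ {n} → F n
𝟘 = replicate _ false

_≟F_ : ∀ {n} (x y : F n) → Relation.Nullary.Dec (x ≡ y)
_≟F_ = ≡-dec B._≟_

elems : (n : ℕ) → List (F n)
elems zero = [ [] ]
elems (suc n) = map (false ∷_) (elems n) ++ map (true ∷_) (elems n)

preimCount : ∀ {n} → (F n → F n) → F n → ℕ
preimCount {n} f y = length (filter (λ x → f x ≟F y) (elems n))

APN : ∀ {n} → (F n → F n) → Set
APN {n} f = ∀ (a : F n) → ¬ (a ≡ 𝟘) → ∀ (b : F n) →
  length (filter (λ x → (f (x ⊕ a) ⊕ f x) ≟F b) (elems n)) ≤ 2

M : ∀ {n} → ℕ → (F n → F n) → ℕ
M {n} r f = length (filter (λ y → preimCount f y N.≟ r) (elems n))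

Npairs : ∀ {n} → (F n → F n) → ℕ
Npairs {n} f = length (filter (λ p → f (proj₁ p) ≟F f (proj₂ p))
                              (cartesianProduct (elems n) (elems n)))

InIm : ∀ {n} → (F n → F n) → F n → Set
InIm {n} f z = ∃ λ (x : F n) → f x ≡ z

UniqueKRest3 : ∀ {n} → ℕ → (F n → F n) → Set
UniqueKRest3 {n} k f =
  Σ (F n) λ y → InIm f y × preimCount f y ≡ k ×
    (∀ (z : F n) → InIm f z → ¬ (z ≡ y) → preimCount f z ≡ 3)

Almost3to1 : ∀ {n} → (F n → F n) → Set
Almost3to1 = UniqueKRest3 1

Even : ℕ → Set
Even n = 2 ∣ n

Odd : ℕ → Set
Odd n = ¬ (2 ∣ n)

-- Write c(y) for the number of preimages of y, so that ∑ c = 2ⁿ and ∑ c² = N(f).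
-- Grouping the pairs (x, x + a) by a, APN bounds N(f) by 2ⁿ + 2(2ⁿ − 1).  Both
-- inequalities follow by summing the pointwise bounds 3k ≤ k² + 2[k ∈ {1,2}] and
-- 4k ≤ k² + 3[k = 1] + 4[k = 2] + 3[k = 3] over k = c(y), whose equality cases are
-- exactly k ≤ 3 and k ≤ 4.  In the equality case of (a) this leaves a single y₀ with
-- c(y₀) ∈ {1, 2}, and 2ⁿ = 3 M₃ + c(y₀) identifies c(y₀) as 2ⁿ mod 3, which is 1 or 2
-- according to the parity of n.  In the equality case of (b), summing the identity
-- k² + 2[k ∈ {1,2}] = 3k + 4[k = 4] (valid for k ≤ 4) gives M₁ + M₂ = 2M₄ + 1.
module Submission where

open import Defs
open import Data.Bool using (true; false; _xor_)
open import Data.Bool.Properties using (xor-same)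
open import Data.List using (List; []; _∷_; _++_; map; filter; length; cartesianProduct)
open import Data.List.Properties using (map-++; map-∘; map-cong; length-++; length-map; filter-some)
open import Data.List.Membership.Propositional using (_∈_; lose)
open import Data.List.Membership.Propositional.Properties
  using (∈-map⁺; ∈-map⁻; ∈-++⁺ˡ; ∈-++⁺ʳ; ∈-filter⁻)
open import Data.List.Relation.Unary.Any using (here; there)
open import Data.List.Relation.Unary.All using ([]) renaming (lookup to All-lookup)
open import Data.List.Relation.Unary.AllPairs using ([]; _∷_)
open import Data.List.Relation.Unary.Unique.Propositional using (Unique)
import Data.List.Relation.Unary.Unique.Propositional.Properties as Unique
open import Data.List.Relation.Binary.Permutation.Propositional using (_↭_; ↭-refl; module PermutationReasoning)
import Data.List.Relation.Binary.Permutation.Propositional.Properties as ↭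
open import Data.Nat using (ℕ; zero; suc; _≤_; _<_; _+_; _*_; _∸_; _^_; z≤n; s≤s; _≟_; _≤?_; NonZero)
open import Data.Nat.DivMod using (_%_; [m+kn]%n≡m%n; %-distribˡ-*; m<n⇒m%n≡m)
open import Data.Nat.Divisibility using (divides)
open import Data.Nat.ListAction using (sum)
open import Data.Nat.ListAction.Properties using (sum-++; sum-↭)
open import Data.Nat.Properties
open import Algebra.Properties.CommutativeSemigroup +-commutativeSemigroup
  using (x∙yz≈y∙xz; x∙yz≈xz∙y; xy∙z≈xz∙y)
open import Data.Nat.Tactic.RingSolver using (solve-∀)
open import Data.Product using (∃; _×_; _,_; proj₁; proj₂; uncurry)
open import Data.Sum using (_⊎_; inj₁; inj₂)
open import Data.Vec using ([]; _∷_)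
open import Data.Vec.Properties using (∷-injectiveʳ)
open import Function using (_∘_)
open import Function.Bundles using (_⇔_; mk⇔; Equivalence)
import Function.Properties.Equivalence as ⇔
open import Data.Product.Function.NonDependent.Propositional using (_×-⇔_)
open import Relation.Binary.PropositionalEquality
open import Relation.Nullary using (¬_; Dec; yes; no; contradiction)
open import Relation.Unary using (Pred; Decidable)

∑ : ∀ {a} {A : Set a} → List A → (A → ℕ) → ℕ
∑ xs φ = sum (map φ xs)

infix 5 ∑
syntax ∑ xs (λ x → e) = ∑[ x ∈ xs ] e

𝟙 : ∀ {p} {P : Set p} → Dec P → ℕ
𝟙 (yes _) = 1
𝟙 (no _) = 0

module _ {p} {P : Set p} where

  𝟙-yes : (d : Dec P) → P → 𝟙 d ≡ 1
  𝟙-yes (yes _) _ = refl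
  𝟙-yes (no ¬p) p = contradiction p ¬p

  𝟙-no : (d : Dec P) → ¬ P → 𝟙 d ≡ 0
  𝟙-no (yes p) ¬p = contradiction p ¬p
  𝟙-no (no _) _ = refl

  𝟙≤1 : (d : Dec P) → 𝟙 d ≤ 1
  𝟙≤1 (yes _) = ≤-refl
  𝟙≤1 (no _) = z≤n

𝟙-mono : ∀ {p q} {P : Set p} {Q : Set q} (d : Dec P) (e : Dec Q) → (P → Q) → 𝟙 d ≤ 𝟙 e
𝟙-mono (yes p) e P⇒Q = ≤-reflexive (sym (𝟙-yes e (P⇒Q p)))
𝟙-mono (no _) e _ = z≤n

𝟙-cong : ∀ {p q} {P : Set p} {Q : Set q} (d : Dec P) (e : Dec Q) → (P → Q) → (Q → P) → 𝟙 d ≡ 𝟙 e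
𝟙-cong d e P⇒Q Q⇒P = ≤-antisym (𝟙-mono d e P⇒Q) (𝟙-mono e d Q⇒P)

+-tight : ∀ {m n o p} → m ≤ n → o ≤ p → n + p ≤ m + o → m ≡ n × o ≡ p
+-tight {m} {n} {o} {p} m≤n o≤p le =
  ≤-antisym m≤n (+-cancelʳ-≤ p n m (≤-trans le (+-monoʳ-≤ m o≤p))) ,
  ≤-antisym o≤p (+-cancelˡ-≤ n p o (≤-trans le (+-monoˡ-≤ o m≤n)))

module _ {a} {A : Set a} where

  ∑-cong : (xs : List A) {φ ψ : A → ℕ} → (∀ x → φ x ≡ ψ x) → ∑ xs φ ≡ ∑ xs ψ
  ∑-cong xs h = cong sum (map-cong h xs)

  ∑-+ : (xs : List A) (φ ψ : A → ℕ) → ∑[ x ∈ xs ] (φ x + ψ x) ≡ ∑ xs φ + ∑ xs ψ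
  ∑-+ [] φ ψ = refl
  ∑-+ (x ∷ xs) φ ψ = begin
    φ x + ψ x + (∑[ y ∈ xs ] (φ y + ψ y)) ≡⟨ cong (φ x + ψ x +_) (∑-+ xs φ ψ) ⟩
    φ x + ψ x + (∑ xs φ + ∑ xs ψ)       ≡⟨ +-assoc (φ x) (ψ x) _ ⟩
    φ x + (ψ x + (∑ xs φ + ∑ xs ψ))     ≡⟨ cong (φ x +_) (x∙yz≈y∙xz (ψ x) (∑ xs φ) (∑ xs ψ)) ⟩
    φ x + (∑ xs φ + (ψ x + ∑ xs ψ))     ≡⟨ +-assoc (φ x) (∑ xs φ) _ ⟨
    φ x + ∑ xs φ + (ψ x + ∑ xs ψ)       ∎
    where open ≡-Reasoning

  ∑-*ˡ : (xs : List A) (k : ℕ) (φ : A → ℕ) → ∑[ x ∈ xs ] (k * φ x) ≡ k * ∑ xs φ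
  ∑-*ˡ [] k φ = sym (*-zeroʳ k)
  ∑-*ˡ (x ∷ xs) k φ = trans (cong (k * φ x +_) (∑-*ˡ xs k φ)) (sym (*-distribˡ-+ k (φ x) (∑ xs φ)))

  ∑-const : (xs : List A) (k : ℕ) → ∑[ _ ∈ xs ] k ≡ k * length xs
  ∑-const [] k = sym (*-zeroʳ k)
  ∑-const (x ∷ xs) k = trans (cong (k +_) (∑-const xs k)) (sym (*-suc k (length xs)))

  ∑-mono-≤ : (xs : List A) {φ ψ : A → ℕ} → (∀ x → φ x ≤ ψ x) → ∑ xs φ ≤ ∑ xs ψ
  ∑-mono-≤ [] h = z≤n
  ∑-mono-≤ (x ∷ xs) h = +-mono-≤ (h x) (∑-mono-≤ xs h)

  ∑-mono-≤-tight : (xs : List A) {φ ψ : A → ℕ} → (∀ x → φ x ≤ ψ x) → ∑ xs ψ ≤ ∑ xs φ →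
                   ∀ {x} → x ∈ xs → φ x ≡ ψ x
  ∑-mono-≤-tight (y ∷ xs) h le (here refl) = proj₁ (+-tight (h y) (∑-mono-≤ xs h) le)
  ∑-mono-≤-tight (y ∷ xs) h le (there x∈xs) =
    ∑-mono-≤-tight xs h (≤-reflexive (sym (proj₂ (+-tight (h y) (∑-mono-≤ xs h) le)))) x∈xs

  ∑-term-≤ : (xs : List A) (φ : A → ℕ) → ∀ {x} → x ∈ xs → φ x ≤ ∑ xs φ
  ∑-term-≤ (y ∷ xs) φ (here refl) = m≤m+n (φ y) (∑ xs φ)
  ∑-term-≤ (y ∷ xs) φ (there x∈xs) = m≤n⇒m≤o+n (φ y) (∑-term-≤ xs φ x∈xs)

  ∑≡0⇒ : (xs : List A) {φ : A → ℕ} → ∑ xs φ ≡ 0 → ∀ {x} → x ∈ xs → φ x ≡ 0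
  ∑≡0⇒ xs {φ} eq x∈xs = n≤0⇒n≡0 (≤-trans (∑-term-≤ xs φ x∈xs) (≤-reflexive eq))

  ∑-zero : (xs : List A) {φ : A → ℕ} → (∀ {x} → x ∈ xs → φ x ≡ 0) → ∑ xs φ ≡ 0
  ∑-zero [] h = refl
  ∑-zero (x ∷ xs) h = cong₂ _+_ (h (here refl)) (∑-zero xs (h ∘ there))

  ∑≡1⇒singleSupport : (xs : List A) {φ : A → ℕ} → ∑ xs φ ≡ 1 →
    ∃ λ y → y ∈ xs × φ y ≡ 1 × (∀ {z} → z ∈ xs → z ≢ y → φ z ≡ 0)
  ∑≡1⇒singleSupport (x ∷ xs) {φ} eq with φ x in φx≡
  ... | 1 = x , here refl , φx≡ , vanish
    where
    vanish : ∀ {z} → z ∈ x ∷ xs → z ≢ x → φ z ≡ 0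
    vanish (here refl) z≢x = contradiction refl z≢x
    vanish (there z∈xs) _ = ∑≡0⇒ xs (suc-injective eq) z∈xs
  ... | 0 with ∑≡1⇒singleSupport xs eq
  ...   | y , y∈xs , φy≡1 , vanish = y , there y∈xs , φy≡1 , vanish′
    where
    vanish′ : ∀ {z} → z ∈ x ∷ xs → z ≢ y → φ z ≡ 0
    vanish′ (here refl) _ = φx≡
    vanish′ (there z∈xs) z≢y = vanish z∈xs z≢y
  ∑≡1⇒singleSupport (x ∷ xs) () | suc (suc _)

  ∑-δ : {xs : List A} {φ : A → ℕ} → Unique xs → ∀ {w} → w ∈ xs →
        (∀ {z} → z ∈ xs → z ≢ w → φ z ≡ 0) → ∑ xs φ ≡ φ w
  ∑-δ {x ∷ xs} {φ} (x∉xs ∷ _) (here refl) vanish =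
    trans (cong (φ x +_) (∑-zero xs (λ z∈xs → vanish (there z∈xs) (All-lookup x∉xs z∈xs ∘ sym))))
          (+-identityʳ (φ x))
  ∑-δ {x ∷ xs} {φ} (x∉xs ∷ xs-unique) (there w∈xs) vanish =
    trans (cong (_+ ∑ xs φ) (vanish (here refl) (All-lookup x∉xs w∈xs)))
          (∑-δ xs-unique w∈xs (vanish ∘ there))

  ∑-↭ : {xs ys : List A} (φ : A → ℕ) → xs ↭ ys → ∑ xs φ ≡ ∑ ys φ
  ∑-↭ φ xs↭ys = sum-↭ (↭.map⁺ φ xs↭ys)

  length-filter≡∑𝟙 : ∀ {p} {P : Pred A p} (P? : Decidable P) (xs : List A) →
                     length (filter P? xs) ≡ ∑[ x ∈ xs ] 𝟙 (P? x)
  length-filter≡∑𝟙 P? [] = refl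
  length-filter≡∑𝟙 P? (x ∷ xs) with P? x
  ... | yes _ = cong suc (length-filter≡∑𝟙 P? xs)
  ... | no _ = length-filter≡∑𝟙 P? xs

∑-map : ∀ {a b} {A : Set a} {B : Set b} (xs : List A) (g : A → B) (φ : B → ℕ) →
        ∑ (map g xs) φ ≡ ∑[ x ∈ xs ] φ (g x)
∑-map xs g φ = cong sum (sym (map-∘ xs))

module _ {a b} {A : Set a} {B : Set b} where

  ∑-swap : (xs : List A) (ys : List B) (φ : A → B → ℕ) →
           ∑[ x ∈ xs ] ∑[ y ∈ ys ] φ x y ≡ ∑[ y ∈ ys ] ∑[ x ∈ xs ] φ x y
  ∑-swap [] ys φ = sym (∑-zero ys (λ _ → refl))
  ∑-swap (x ∷ xs) ys φ =
    trans (cong (∑ ys (φ x) +_) (∑-swap xs ys φ)) (sym (∑-+ ys (φ x) (λ y → ∑[ x′ ∈ xs ] φ x′ y)))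

  ∑-cartesianProduct : (xs : List A) (ys : List B) (φ : A × B → ℕ) →
                       ∑ (cartesianProduct xs ys) φ ≡ ∑[ x ∈ xs ] ∑[ y ∈ ys ] φ (x , y)
  ∑-cartesianProduct [] ys φ = refl
  ∑-cartesianProduct (x ∷ xs) ys φ = begin
    ∑ (map (x ,_) ys ++ cartesianProduct xs ys) φ
      ≡⟨ cong sum (map-++ φ (map (x ,_) ys) _) ⟩
    sum (map φ (map (x ,_) ys) ++ map φ (cartesianProduct xs ys))
      ≡⟨ sum-++ (map φ (map (x ,_) ys)) _ ⟩
    ∑ (map (x ,_) ys) φ + ∑ (cartesianProduct xs ys) φ
      ≡⟨ cong₂ _+_ (∑-map ys (x ,_) φ) (∑-cartesianProduct xs ys φ) ⟩
    (∑[ y ∈ ys ] φ (x , y)) + (∑[ x′ ∈ xs ] ∑[ y ∈ ys ] φ (x′ , y)) ∎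
    where open ≡-Reasoning

δ : ℕ → ℕ → ℕ
δ r k = 𝟙 (k ≟ r)

δ₁₂ : ℕ → ℕ
δ₁₂ k = δ 1 k + δ 2 k

w₃₄₃ : ℕ → ℕ
w₃₄₃ k = 3 * δ 1 k + 4 * δ 2 k + 3 * δ 3 k

module Threshold (m : ℕ) {g h : ℕ → ℕ}
  (agree : ∀ {k} → k ≤ m → h k ≡ g k) (exceed : ∀ {k} → m < k → g k < h k) where

  threshold-≤ : ∀ k → g k ≤ h k
  threshold-≤ k with k ≤? m
  ... | yes k≤m = ≤-reflexive (sym (agree k≤m))
  ... | no k≰m = <⇒≤ (exceed (≰⇒> k≰m))

  threshold-≡⇒≤ : ∀ {k} → g k ≡ h k → k ≤ m
  threshold-≡⇒≤ eq = ≮⇒≥ (λ m<k → <⇒≢ (exceed m<k) eq)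

k≤3⇒k²+2δ₁₂≡3k : ∀ {k} → k ≤ 3 → k * k + 2 * δ₁₂ k ≡ 3 * k
k≤3⇒k²+2δ₁₂≡3k {0} _ = refl
k≤3⇒k²+2δ₁₂≡3k {1} _ = refl
k≤3⇒k²+2δ₁₂≡3k {2} _ = refl
k≤3⇒k²+2δ₁₂≡3k {3} _ = refl
k≤3⇒k²+2δ₁₂≡3k {suc (suc (suc (suc _)))} (s≤s (s≤s (s≤s ())))

3<k⇒3k<k²+2δ₁₂ : ∀ {k} → 3 < k → 3 * k < k * k + 2 * δ₁₂ k
3<k⇒3k<k²+2δ₁₂ {k} 3<k@(s≤s (s≤s (s≤s (s≤s _)))) =
  <-≤-trans (*-monoˡ-< k 3<k) (m≤m+n (k * k) 0)

k≤4⇒k²+w₃₄₃≡4k : ∀ {k} → k ≤ 4 → k * k + w₃₄₃ k ≡ 4 * k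
k≤4⇒k²+w₃₄₃≡4k {0} _ = refl
k≤4⇒k²+w₃₄₃≡4k {1} _ = refl
k≤4⇒k²+w₃₄₃≡4k {2} _ = refl
k≤4⇒k²+w₃₄₃≡4k {3} _ = refl
k≤4⇒k²+w₃₄₃≡4k {4} _ = refl
k≤4⇒k²+w₃₄₃≡4k {suc (suc (suc (suc (suc _))))} (s≤s (s≤s (s≤s (s≤s ()))))

4<k⇒4k<k²+w₃₄₃ : ∀ {k} → 4 < k → 4 * k < k * k + w₃₄₃ k
4<k⇒4k<k²+w₃₄₃ {k} 4<k@(s≤s (s≤s (s≤s (s≤s (s≤s _))))) =
  <-≤-trans (*-monoˡ-< k 4<k) (m≤m+n (k * k) 0)

module Bound₁₂ = Threshold 3 k≤3⇒k²+2δ₁₂≡3k 3<k⇒3k<k²+2δ₁₂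
module Bound₃₄₃ = Threshold 4 k≤4⇒k²+w₃₄₃≡4k 4<k⇒4k<k²+w₃₄₃

k≤3⇒k≡3δ₃+kδ₁₂ : ∀ {k} → k ≤ 3 → k ≡ 3 * δ 3 k + k * δ₁₂ k
k≤3⇒k≡3δ₃+kδ₁₂ {0} _ = refl
k≤3⇒k≡3δ₃+kδ₁₂ {1} _ = refl
k≤3⇒k≡3δ₃+kδ₁₂ {2} _ = refl
k≤3⇒k≡3δ₃+kδ₁₂ {3} _ = refl
k≤3⇒k≡3δ₃+kδ₁₂ {suc (suc (suc (suc _)))} (s≤s (s≤s (s≤s ())))

k≤4⇒k²+2δ₁₂≡3k+4δ₄ : ∀ {k} → k ≤ 4 → k * k + 2 * δ₁₂ k ≡ 3 * k + 4 * δ 4 k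
k≤4⇒k²+2δ₁₂≡3k+4δ₄ {0} _ = refl
k≤4⇒k²+2δ₁₂≡3k+4δ₄ {1} _ = refl
k≤4⇒k²+2δ₁₂≡3k+4δ₄ {2} _ = refl
k≤4⇒k²+2δ₁₂≡3k+4δ₄ {3} _ = refl
k≤4⇒k²+2δ₁₂≡3k+4δ₄ {4} _ = refl
k≤4⇒k²+2δ₁₂≡3k+4δ₄ {suc (suc (suc (suc (suc _))))} (s≤s (s≤s (s≤s (s≤s ()))))

δ₁₂≡1⇒0<k<3 : ∀ {k} → δ₁₂ k ≡ 1 → 0 < k × k < 3
δ₁₂≡1⇒0<k<3 {1} _ = s≤s z≤n , s≤s (s≤s z≤n)
δ₁₂≡1⇒0<k<3 {2} _ = s≤s z≤n , s≤s (s≤s (s≤s z≤n))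
δ₁₂≡1⇒0<k<3 {0} ()
δ₁₂≡1⇒0<k<3 {suc (suc (suc _))} ()

δ₁₂≡0⇒k≡3 : ∀ {k} → 0 < k → k ≤ 3 → δ₁₂ k ≡ 0 → k ≡ 3
δ₁₂≡0⇒k≡3 {3} _ _ _ = refl
δ₁₂≡0⇒k≡3 {1} _ _ ()
δ₁₂≡0⇒k≡3 {2} _ _ ()
δ₁₂≡0⇒k≡3 {suc (suc (suc (suc _)))} _ (s≤s (s≤s (s≤s ()))) _

⊕-self : ∀ {n} (x : F n) → x ⊕ x ≡ 𝟘
⊕-self [] = refl
⊕-self (b ∷ x) = cong₂ _∷_ (xor-same b) (⊕-self x)

elems-complete : ∀ n (x : F n) → x ∈ elems n
elems-complete zero [] = here refl
elems-complete (suc n) (false ∷ x) = ∈-++⁺ˡ (∈-map⁺ (false ∷_) (elems-complete n x))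
elems-complete (suc n) (true ∷ x) = ∈-++⁺ʳ (map (false ∷_) (elems n)) (∈-map⁺ (true ∷_) (elems-complete n x))

elems-unique : ∀ n → Unique (elems n)
elems-unique zero = [] ∷ []
elems-unique (suc n) = Unique.++⁺ (Unique.map⁺ ∷-injectiveʳ (elems-unique n))
                                  (Unique.map⁺ ∷-injectiveʳ (elems-unique n)) disjoint
  where
  disjoint : ∀ {v} → ¬ (v ∈ map (false ∷_) (elems n) × v ∈ map (true ∷_) (elems n))
  disjoint (v∈₀ , v∈₁) with ∈-map⁻ (false ∷_) v∈₀ | ∈-map⁻ (true ∷_) v∈₁
  ... | _ , _ , refl | _ , _ , ()

elems-length : ∀ n → length (elems n) ≡ 2 ^ n
elems-length zero = refl
elems-length (suc n) = begin
  length (map (false ∷_) (elems n) ++ map (true ∷_) (elems n))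
    ≡⟨ length-++ (map (false ∷_) (elems n)) ⟩
  length (map (false ∷_) (elems n)) + length (map (true ∷_) (elems n))
    ≡⟨ cong₂ _+_ (length-map (false ∷_) (elems n)) (length-map (true ∷_) (elems n)) ⟩
  length (elems n) + length (elems n)
    ≡⟨ cong (λ t → t + t) (elems-length n) ⟩
  2 ^ n + 2 ^ n
    ≡⟨ cong (2 ^ n +_) (+-identityʳ (2 ^ n)) ⟨
  2 * 2 ^ n ∎
  where open ≡-Reasoning

⊕-elems-↭ : ∀ {n} (a : F n) → map (a ⊕_) (elems n) ↭ elems n
⊕-elems-↭ {zero} [] = ↭-refl
⊕-elems-↭ {suc n} (b ∷ a) = begin
  map ((b ∷ a) ⊕_) (map (false ∷_) (elems n) ++ map (true ∷_) (elems n))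
    ≡⟨ map-++ ((b ∷ a) ⊕_) (map (false ∷_) (elems n)) _ ⟩
  map ((b ∷ a) ⊕_) (map (false ∷_) (elems n)) ++ map ((b ∷ a) ⊕_) (map (true ∷_) (elems n))
    ↭⟨ ↭.++⁺ (translate-slice false) (translate-slice true) ⟩
  map ((b xor false) ∷_) (elems n) ++ map ((b xor true) ∷_) (elems n)
    ↭⟨ swap-slices b ⟩
  elems (suc n) ∎
  where
  open PermutationReasoning
  translate-slice : ∀ c → map ((b ∷ a) ⊕_) (map (c ∷_) (elems n)) ↭ map ((b xor c) ∷_) (elems n)
  translate-slice c = begin
    map ((b ∷ a) ⊕_) (map (c ∷_) (elems n))        ≡⟨ map-∘ (elems n) ⟨
    map (λ y → (b xor c) ∷ (a ⊕ y)) (elems n)       ≡⟨ map-∘ (elems n) ⟩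
    map ((b xor c) ∷_) (map (a ⊕_) (elems n))       ↭⟨ ↭.map⁺ ((b xor c) ∷_) (⊕-elems-↭ a) ⟩
    map ((b xor c) ∷_) (elems n)                    ∎
  swap-slices : ∀ b → map ((b xor false) ∷_) (elems n) ++ map ((b xor true) ∷_) (elems n) ↭ elems (suc n)
  swap-slices false = ↭-refl
  swap-slices true = ↭.++-comm (map (true ∷_) (elems n)) (map (false ∷_) (elems n))

[n*q+r]%n≡r : ∀ n q r .{{_ : NonZero n}} → r < n → (n * q + r) % n ≡ r
[n*q+r]%n≡r n q r r<n = begin
  (n * q + r) % n ≡⟨ cong (_% n) (trans (+-comm (n * q) r) (cong (r +_) (*-comm n q))) ⟩
  (r + q * n) % n ≡⟨ [m+kn]%n≡m%n r q n ⟩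
  r % n           ≡⟨ m<n⇒m%n≡m r<n ⟩
  r               ∎
  where open ≡-Reasoning

even-or-odd : ∀ n → (∃ λ q → n ≡ q * 2) ⊎ (∃ λ q → n ≡ 1 + q * 2)
even-or-odd zero = inj₁ (0 , refl)
even-or-odd (suc n) with even-or-odd n
... | inj₁ (q , n≡2q) = inj₂ (q , cong suc n≡2q)
... | inj₂ (q , n≡1+2q) = inj₁ (suc q , cong suc n≡1+2q)

2^[2q]%3≡1 : ∀ q → 2 ^ (q * 2) % 3 ≡ 1
2^[2q]%3≡1 zero = refl
2^[2q]%3≡1 (suc q) = begin
  2 * (2 * 2 ^ (q * 2)) % 3           ≡⟨ cong (_% 3) (4x≡x+x*3 (2 ^ (q * 2))) ⟩
  (2 ^ (q * 2) + 2 ^ (q * 2) * 3) % 3 ≡⟨ [m+kn]%n≡m%n (2 ^ (q * 2)) (2 ^ (q * 2)) 3 ⟩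
  2 ^ (q * 2) % 3                     ≡⟨ 2^[2q]%3≡1 q ⟩
  1                                   ∎
  where
  open ≡-Reasoning
  4x≡x+x*3 : ∀ x → 2 * (2 * x) ≡ x + x * 3
  4x≡x+x*3 = solve-∀

Even⇒2^n%3≡1 : ∀ {n} → Even n → 2 ^ n % 3 ≡ 1
Even⇒2^n%3≡1 (divides q refl) = 2^[2q]%3≡1 q

Odd⇒2^n%3≡2 : ∀ {n} → Odd n → 2 ^ n % 3 ≡ 2
Odd⇒2^n%3≡2 {n} n-odd with even-or-odd n
... | inj₁ (q , n≡2q) = contradiction (divides q n≡2q) n-odd
... | inj₂ (q , refl) = begin
  2 * 2 ^ (q * 2) % 3               ≡⟨ %-distribˡ-* 2 (2 ^ (q * 2)) 3 ⟩
  2 % 3 * (2 ^ (q * 2) % 3) % 3     ≡⟨ cong (λ r → 2 * r % 3) (2^[2q]%3≡1 q) ⟩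
  2                                 ∎
  where open ≡-Reasoning

m≡n∸o⇔m+o≡n : ∀ {m n o} → o ≤ n → (m ≡ n ∸ o ⇔ m + o ≡ n)
m≡n∸o⇔m+o≡n {m} {o = o} o≤n = mk⇔
  (λ m≡n∸o → trans (cong (_+ o) m≡n∸o) (m∸n+n≡m o≤n))
  (λ m+o≡n → trans (sym (m+n∸n≡m m o)) (cong (_∸ o) m+o≡n))

∑-select : ∀ {n} (a : F n) (φ : F n → ℕ) → ∑[ y ∈ elems n ] φ y * 𝟙 (a ≟F y) ≡ φ a
∑-select {n} a φ = begin
  ∑[ y ∈ elems n ] φ y * 𝟙 (a ≟F y) ≡⟨ ∑-δ (elems-unique n) (elems-complete n a) vanish ⟩
  φ a * 𝟙 (a ≟F a)                   ≡⟨ cong (φ a *_) (𝟙-yes (a ≟F a) refl) ⟩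
  φ a * 1                            ≡⟨ *-identityʳ (φ a) ⟩
  φ a                                ∎
  where
  open ≡-Reasoning
  vanish : ∀ {z} → z ∈ elems n → z ≢ a → φ z * 𝟙 (a ≟F z) ≡ 0
  vanish {z} _ z≢a = trans (cong (φ z *_) (𝟙-no (a ≟F z) (z≢a ∘ sym))) (*-zeroʳ (φ z))

module PreimageCounts {n : ℕ} (f : F n → F n) where

  c : F n → ℕ
  c = preimCount f

  preimCount≡∑ : ∀ y → c y ≡ ∑[ x ∈ elems n ] 𝟙 (f x ≟F y)
  preimCount≡∑ y = length-filter≡∑𝟙 (λ x → f x ≟F y) (elems n)

  M≡∑δ : ∀ r → M r f ≡ ∑[ y ∈ elems n ] δ r (c y)
  M≡∑δ r = length-filter≡∑𝟙 (λ y → c y ≟ r) (elems n)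

  Npairs≡∑∑ : Npairs f ≡ ∑[ x ∈ elems n ] ∑[ x′ ∈ elems n ] 𝟙 (f x ≟F f x′)
  Npairs≡∑∑ = trans (length-filter≡∑𝟙 collide? (cartesianProduct (elems n) (elems n)))
                    (∑-cartesianProduct (elems n) (elems n) (𝟙 ∘ collide?))
    where
    collide? : ∀ p → Dec (f (proj₁ p) ≡ f (proj₂ p))
    collide? p = f (proj₁ p) ≟F f (proj₂ p)

  preimCount>0⇒InIm : ∀ {y} → 0 < c y → InIm f y
  preimCount>0⇒InIm {y} c>0 with filter (λ x → f x ≟F y) (elems n) in preimages | c>0
  ... | x ∷ _ | _ =
    x , proj₂ (∈-filter⁻ (λ x → f x ≟F y) {xs = elems n} (subst (x ∈_) (sym preimages) (here refl)))

  InIm⇒preimCount>0 : ∀ {y} → InIm f y → 0 < c y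
  InIm⇒preimCount>0 {y} (x , fx≡y) = filter-some (λ x → f x ≟F y) (lose (elems-complete n x) fx≡y)

  preimCount≡0⊎InIm : ∀ y → c y ≡ 0 ⊎ InIm f y
  preimCount≡0⊎InIm y with c y ≟ 0
  ... | yes c≡0 = inj₁ c≡0
  ... | no c≢0 = inj₂ (preimCount>0⇒InIm (n≢0⇒n>0 c≢0))

  ∑-preimCount : ∑ (elems n) c ≡ 2 ^ n
  ∑-preimCount = begin
    ∑[ y ∈ elems n ] c y                                  ≡⟨ ∑-cong (elems n) preimCount≡∑ ⟩
    ∑[ y ∈ elems n ] ∑[ x ∈ elems n ] 𝟙 (f x ≟F y)        ≡⟨ ∑-swap (elems n) (elems n) _ ⟩
    ∑[ x ∈ elems n ] ∑[ y ∈ elems n ] 𝟙 (f x ≟F y)        ≡⟨ ∑-cong (elems n) (λ x →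
      trans (∑-cong (elems n) (λ y → sym (*-identityˡ _))) (∑-select (f x) (λ _ → 1))) ⟩
    ∑[ x ∈ elems n ] 1                                    ≡⟨ ∑-const (elems n) 1 ⟩
    1 * length (elems n)                                  ≡⟨ *-identityˡ _ ⟩
    length (elems n)                                      ≡⟨ elems-length n ⟩
    2 ^ n                                                 ∎
    where open ≡-Reasoning

  ∑-preimCount² : ∑[ y ∈ elems n ] c y * c y ≡ Npairs f
  ∑-preimCount² = begin
    ∑[ y ∈ elems n ] c y * c y                            ≡⟨ ∑-cong (elems n) (λ y →
      trans (cong (c y *_) (preimCount≡∑ y)) (sym (∑-*ˡ (elems n) (c y) _))) ⟩
    ∑[ y ∈ elems n ] ∑[ x ∈ elems n ] c y * 𝟙 (f x ≟F y)  ≡⟨ ∑-swap (elems n) (elems n) _ ⟩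
    ∑[ x ∈ elems n ] ∑[ y ∈ elems n ] c y * 𝟙 (f x ≟F y)  ≡⟨ ∑-cong (elems n) (λ x → ∑-select (f x) c) ⟩
    ∑[ x ∈ elems n ] c (f x)                              ≡⟨ ∑-cong (elems n) (λ x →
      trans (preimCount≡∑ (f x))
            (∑-cong (elems n) (λ x′ → 𝟙-cong (f x′ ≟F f x) (f x ≟F f x′) sym sym))) ⟩
    ∑[ x ∈ elems n ] ∑[ x′ ∈ elems n ] 𝟙 (f x ≟F f x′)    ≡⟨ Npairs≡∑∑ ⟨
    Npairs f                                              ∎
    where open ≡-Reasoning

  collisions : F n → ℕ
  collisions a = ∑[ x ∈ elems n ] 𝟙 (f x ≟F f (x ⊕ a))

  Npairs≡∑collisions : Npairs f ≡ ∑ (elems n) collisions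
  Npairs≡∑collisions = begin
    Npairs f                                               ≡⟨ Npairs≡∑∑ ⟩
    ∑[ x ∈ elems n ] ∑[ x′ ∈ elems n ] 𝟙 (f x ≟F f x′)     ≡⟨ ∑-cong (elems n) (λ x →
      trans (sym (∑-↭ _ (⊕-elems-↭ x))) (∑-map (elems n) (x ⊕_) _)) ⟩
    ∑[ x ∈ elems n ] ∑[ a ∈ elems n ] 𝟙 (f x ≟F f (x ⊕ a)) ≡⟨ ∑-swap (elems n) (elems n) _ ⟩
    ∑[ a ∈ elems n ] ∑[ x ∈ elems n ] 𝟙 (f x ≟F f (x ⊕ a)) ∎
    where open ≡-Reasoning

  collisions≤2ⁿ : ∀ a → collisions a ≤ 2 ^ n
  collisions≤2ⁿ a = begin
    collisions a          ≤⟨ ∑-mono-≤ (elems n) (λ x → 𝟙≤1 (f x ≟F f (x ⊕ a))) ⟩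
    ∑[ _ ∈ elems n ] 1    ≡⟨ ∑-const (elems n) 1 ⟩
    1 * length (elems n)  ≡⟨ *-identityˡ _ ⟩
    length (elems n)      ≡⟨ elems-length n ⟩
    2 ^ n                 ∎
    where open ≤-Reasoning

  collisions≤2 : APN f → ∀ a → a ≢ 𝟘 → collisions a ≤ 2
  collisions≤2 apn a a≢𝟘 = begin
    collisions a
      ≤⟨ ∑-mono-≤ (elems n) (λ x → 𝟙-mono (f x ≟F f (x ⊕ a)) ((f (x ⊕ a) ⊕ f x) ≟F 𝟘)
           (λ fx≡ → trans (cong (_⊕ f x) (sym fx≡)) (⊕-self (f x)))) ⟩
    ∑[ x ∈ elems n ] 𝟙 ((f (x ⊕ a) ⊕ f x) ≟F 𝟘)
      ≡⟨ length-filter≡∑𝟙 (λ x → (f (x ⊕ a) ⊕ f x) ≟F 𝟘) (elems n) ⟨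
    length (filter (λ x → (f (x ⊕ a) ⊕ f x) ≟F 𝟘) (elems n))
      ≤⟨ apn a a≢𝟘 𝟘 ⟩
    2 ∎
    where open ≤-Reasoning

  Npairs+2≤3·2ⁿ : APN f → Npairs f + 2 ≤ 3 * 2 ^ n
  Npairs+2≤3·2ⁿ apn = begin
    Npairs f + 2
      ≡⟨ cong₂ _+_ Npairs≡∑collisions (sym (cong (2 *_) ∑isZero)) ⟩
    ∑ (elems n) collisions + 2 * ∑ (elems n) isZero
      ≡⟨ trans (∑-+ (elems n) collisions _) (cong (∑ (elems n) collisions +_) (∑-*ˡ (elems n) 2 isZero)) ⟨
    ∑[ a ∈ elems n ] (collisions a + 2 * isZero a)
      ≤⟨ ∑-mono-≤ (elems n) pointwise ⟩
    ∑[ a ∈ elems n ] (2 ^ n * isZero a + 2)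
      ≡⟨ ∑-+ (elems n) _ (λ _ → 2) ⟩
    (∑[ a ∈ elems n ] 2 ^ n * isZero a) + (∑[ _ ∈ elems n ] 2)
      ≡⟨ cong₂ _+_ (trans (∑-*ˡ (elems n) (2 ^ n) isZero) (cong (2 ^ n *_) ∑isZero))
                   (trans (∑-const (elems n) 2) (cong (2 *_) (elems-length n))) ⟩
    2 ^ n * 1 + 2 * 2 ^ n
      ≡⟨ cong (_+ 2 * 2 ^ n) (*-identityʳ (2 ^ n)) ⟩
    3 * 2 ^ n ∎
    where
    open ≤-Reasoning
    isZero : F n → ℕ
    isZero a = 𝟙 (𝟘 ≟F a)
    ∑isZero : ∑ (elems n) isZero ≡ 1
    ∑isZero = trans (∑-cong (elems n) (λ a → sym (*-identityˡ (isZero a)))) (∑-select {n} 𝟘 (λ _ → 1))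
    pointwise : ∀ a → collisions a + 2 * isZero a ≤ 2 ^ n * isZero a + 2
    pointwise a with 𝟘 ≟F a
    ... | yes _ = +-monoˡ-≤ 2 (≤-trans (collisions≤2ⁿ a) (≤-reflexive (sym (*-identityʳ (2 ^ n)))))
    ... | no 𝟘≢a = begin
      collisions a + 0  ≡⟨ +-identityʳ (collisions a) ⟩
      collisions a      ≤⟨ collisions≤2 apn a (𝟘≢a ∘ sym) ⟩
      2                 ≤⟨ m≤n+m 2 (2 ^ n * 0) ⟩
      2 ^ n * 0 + 2     ∎

  ∑-scaled-δ : ∀ k r → ∑[ y ∈ elems n ] k * δ r (c y) ≡ k * M r f
  ∑-scaled-δ k r = trans (∑-*ˡ (elems n) k _) (cong (k *_) (sym (M≡∑δ r)))

  ∑-scaled-preimCount : ∀ k → ∑[ y ∈ elems n ] k * c y ≡ k * 2 ^ n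
  ∑-scaled-preimCount k = trans (∑-*ˡ (elems n) k c) (cong (k *_) ∑-preimCount)

  ∑-δ₁₂ : ∑[ y ∈ elems n ] δ₁₂ (c y) ≡ M 1 f + M 2 f
  ∑-δ₁₂ = trans (∑-+ (elems n) _ _) (sym (cong₂ _+_ (M≡∑δ 1) (M≡∑δ 2)))

  ∑-k²+2δ₁₂ : ∑[ y ∈ elems n ] (c y * c y + 2 * δ₁₂ (c y)) ≡ Npairs f + 2 * (M 1 f + M 2 f)
  ∑-k²+2δ₁₂ = trans (∑-+ (elems n) _ _)
    (cong₂ _+_ ∑-preimCount² (trans (∑-*ˡ (elems n) 2 _) (cong (2 *_) ∑-δ₁₂)))

  M₃₄₃ : ℕ
  M₃₄₃ = 3 * M 1 f + 4 * M 2 f + 3 * M 3 f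

  ∑-k²+w₃₄₃ : ∑[ y ∈ elems n ] (c y * c y + w₃₄₃ (c y)) ≡ Npairs f + M₃₄₃
  ∑-k²+w₃₄₃ = trans (∑-+ (elems n) _ _) (cong₂ _+_ ∑-preimCount²
    (trans (∑-+ (elems n) _ _) (cong₂ _+_
      (trans (∑-+ (elems n) _ _) (cong₂ _+_ (∑-scaled-δ 3 1) (∑-scaled-δ 4 2)))
      (∑-scaled-δ 3 3))))

  3·2ⁿ≤Npairs+2[M₁+M₂] : 3 * 2 ^ n ≤ Npairs f + 2 * (M 1 f + M 2 f)
  3·2ⁿ≤Npairs+2[M₁+M₂] = begin
    3 * 2 ^ n                                        ≡⟨ ∑-scaled-preimCount 3 ⟨
    ∑[ y ∈ elems n ] 3 * c y                         ≤⟨ ∑-mono-≤ (elems n) (Bound₁₂.threshold-≤ ∘ c) ⟩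
    ∑[ y ∈ elems n ] (c y * c y + 2 * δ₁₂ (c y))     ≡⟨ ∑-k²+2δ₁₂ ⟩
    Npairs f + 2 * (M 1 f + M 2 f)                   ∎
    where open ≤-Reasoning

  M₁+M₂≥1 : APN f → 1 ≤ M 1 f + M 2 f
  M₁+M₂≥1 apn = *-cancelˡ-≤ 2 (+-cancelˡ-≤ (Npairs f) 2 _
    (≤-trans (Npairs+2≤3·2ⁿ apn) 3·2ⁿ≤Npairs+2[M₁+M₂]))

  M₁+M₂≡1⇒preimCount≤3 : APN f → M 1 f + M 2 f ≡ 1 → ∀ y → c y ≤ 3
  M₁+M₂≡1⇒preimCount≤3 apn M₁₂≡1 y = Bound₁₂.threshold-≡⇒≤
    (∑-mono-≤-tight (elems n) (Bound₁₂.threshold-≤ ∘ c) tight (elems-complete n y))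
    where
    tight : ∑[ y ∈ elems n ] (c y * c y + 2 * δ₁₂ (c y)) ≤ ∑[ y ∈ elems n ] 3 * c y
    tight = begin
      ∑[ y ∈ elems n ] (c y * c y + 2 * δ₁₂ (c y)) ≡⟨ ∑-k²+2δ₁₂ ⟩
      Npairs f + 2 * (M 1 f + M 2 f)               ≡⟨ cong (λ m → Npairs f + 2 * m) M₁₂≡1 ⟩
      Npairs f + 2                                 ≤⟨ Npairs+2≤3·2ⁿ apn ⟩
      3 * 2 ^ n                                    ≡⟨ ∑-scaled-preimCount 3 ⟨
      ∑[ y ∈ elems n ] 3 * c y                     ∎
      where open ≤-Reasoning

  M₁+M₂≡1⇒UniqueKRest3 : APN f → M 1 f + M 2 f ≡ 1 → UniqueKRest3 (2 ^ n % 3) f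
  M₁+M₂≡1⇒UniqueKRest3 apn M₁₂≡1 with ∑≡1⇒singleSupport (elems n) (trans ∑-δ₁₂ M₁₂≡1)
  ... | y₀ , _ , δ₁₂[c₀]≡1 , vanish = y₀ , preimCount>0⇒InIm 0<c₀ , c₀≡2ⁿ%3 , others≡3
    where
    c≤3 : ∀ y → c y ≤ 3
    c≤3 = M₁+M₂≡1⇒preimCount≤3 apn M₁₂≡1
    0<c₀ : 0 < c y₀
    0<c₀ = proj₁ (δ₁₂≡1⇒0<k<3 δ₁₂[c₀]≡1)
    c₀<3 : c y₀ < 3
    c₀<3 = proj₂ (δ₁₂≡1⇒0<k<3 δ₁₂[c₀]≡1)
    others≡3 : ∀ z → InIm f z → z ≢ y₀ → c z ≡ 3
    others≡3 z z∈Im z≢y₀ =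
      δ₁₂≡0⇒k≡3 (InIm⇒preimCount>0 z∈Im) (c≤3 z) (vanish (elems-complete n z) z≢y₀)
    2ⁿ≡3M₃+c₀ : 2 ^ n ≡ 3 * M 3 f + c y₀
    2ⁿ≡3M₃+c₀ = begin
      2 ^ n
        ≡⟨ ∑-preimCount ⟨
      ∑[ y ∈ elems n ] c y
        ≡⟨ ∑-cong (elems n) (k≤3⇒k≡3δ₃+kδ₁₂ ∘ c≤3) ⟩
      ∑[ y ∈ elems n ] (3 * δ 3 (c y) + c y * δ₁₂ (c y))
        ≡⟨ ∑-+ (elems n) _ _ ⟩
      (∑[ y ∈ elems n ] 3 * δ 3 (c y)) + (∑[ y ∈ elems n ] c y * δ₁₂ (c y))
        ≡⟨ cong₂ _+_ (∑-scaled-δ 3 3) (∑-δ (elems-unique n) (elems-complete n y₀)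
             (λ {z} z∈ z≢y₀ → trans (cong (c z *_) (vanish z∈ z≢y₀)) (*-zeroʳ (c z)))) ⟩
      3 * M 3 f + c y₀ * δ₁₂ (c y₀)
        ≡⟨ cong (λ t → 3 * M 3 f + c y₀ * t) δ₁₂[c₀]≡1 ⟩
      3 * M 3 f + c y₀ * 1
        ≡⟨ cong (3 * M 3 f +_) (*-identityʳ (c y₀)) ⟩
      3 * M 3 f + c y₀ ∎
      where open ≡-Reasoning
    c₀≡2ⁿ%3 : c y₀ ≡ 2 ^ n % 3
    c₀≡2ⁿ%3 = sym (trans (cong (_% 3) 2ⁿ≡3M₃+c₀) ([n*q+r]%n≡r 3 (M 3 f) (c y₀) c₀<3))

  UniqueKRest3⇒M₁+M₂≡1 : ∀ {k} → δ₁₂ k ≡ 1 → UniqueKRest3 k f → M 1 f + M 2 f ≡ 1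
  UniqueKRest3⇒M₁+M₂≡1 {k} δ₁₂k≡1 (y₀ , _ , c₀≡k , others≡3) = begin
    M 1 f + M 2 f               ≡⟨ ∑-δ₁₂ ⟨
    ∑[ y ∈ elems n ] δ₁₂ (c y)  ≡⟨ ∑-δ (elems-unique n) (elems-complete n y₀) vanish ⟩
    δ₁₂ (c y₀)                  ≡⟨ cong δ₁₂ c₀≡k ⟩
    δ₁₂ k                       ≡⟨ δ₁₂k≡1 ⟩
    1                           ∎
    where
    open ≡-Reasoning
    vanish : ∀ {z} → z ∈ elems n → z ≢ y₀ → δ₁₂ (c z) ≡ 0
    vanish {z} _ z≢y₀ with preimCount≡0⊎InIm z
    ... | inj₁ c≡0 = cong δ₁₂ c≡0
    ... | inj₂ z∈Im = cong δ₁₂ (others≡3 z z∈Im z≢y₀)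

  4·2ⁿ≤Npairs+M₃₄₃ : 4 * 2 ^ n ≤ Npairs f + M₃₄₃
  4·2ⁿ≤Npairs+M₃₄₃ = begin
    4 * 2 ^ n                                    ≡⟨ ∑-scaled-preimCount 4 ⟨
    ∑[ y ∈ elems n ] 4 * c y                     ≤⟨ ∑-mono-≤ (elems n) (Bound₃₄₃.threshold-≤ ∘ c) ⟩
    ∑[ y ∈ elems n ] (c y * c y + w₃₄₃ (c y))    ≡⟨ ∑-k²+w₃₄₃ ⟩
    Npairs f + M₃₄₃                              ∎
    where open ≤-Reasoning

  2ⁿ+2≤M₃₄₃ : APN f → 2 ^ n + 2 ≤ M₃₄₃
  2ⁿ+2≤M₃₄₃ apn = +-cancelˡ-≤ (3 * 2 ^ n) _ _ (begin
    3 * 2 ^ n + (2 ^ n + 2)  ≡⟨ 3t+[t+2]≡4t+2 (2 ^ n) ⟩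
    4 * 2 ^ n + 2            ≤⟨ +-monoˡ-≤ 2 4·2ⁿ≤Npairs+M₃₄₃ ⟩
    Npairs f + M₃₄₃ + 2      ≡⟨ xy∙z≈xz∙y (Npairs f) M₃₄₃ 2 ⟩
    Npairs f + 2 + M₃₄₃      ≤⟨ +-monoˡ-≤ M₃₄₃ (Npairs+2≤3·2ⁿ apn) ⟩
    3 * 2 ^ n + M₃₄₃         ∎)
    where
    open ≤-Reasoning
    3t+[t+2]≡4t+2 : ∀ t → 3 * t + (t + 2) ≡ 4 * t + 2
    3t+[t+2]≡4t+2 = solve-∀

  M₃₄₃≡2ⁿ+2⇒Npairs+2≡3·2ⁿ : APN f → M₃₄₃ ≡ 2 ^ n + 2 → Npairs f + 2 ≡ 3 * 2 ^ n
  M₃₄₃≡2ⁿ+2⇒Npairs+2≡3·2ⁿ apn M≡ =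
    ≤-antisym (Npairs+2≤3·2ⁿ apn) (+-cancelʳ-≤ (2 ^ n) _ _ (begin
      3 * 2 ^ n + 2 ^ n        ≡⟨ +-comm (3 * 2 ^ n) (2 ^ n) ⟩
      4 * 2 ^ n                ≤⟨ 4·2ⁿ≤Npairs+M₃₄₃ ⟩
      Npairs f + M₃₄₃          ≡⟨ cong (Npairs f +_) M≡ ⟩
      Npairs f + (2 ^ n + 2)   ≡⟨ x∙yz≈xz∙y (Npairs f) (2 ^ n) 2 ⟩
      Npairs f + 2 + 2 ^ n     ∎))
    where open ≤-Reasoning

  M₃₄₃≡2ⁿ+2⇒preimCount≤4 : APN f → M₃₄₃ ≡ 2 ^ n + 2 → ∀ y → c y ≤ 4
  M₃₄₃≡2ⁿ+2⇒preimCount≤4 apn M≡ y = Bound₃₄₃.threshold-≡⇒≤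
    (∑-mono-≤-tight (elems n) (Bound₃₄₃.threshold-≤ ∘ c) tight (elems-complete n y))
    where
    open ≤-Reasoning
    tight : ∑[ y ∈ elems n ] (c y * c y + w₃₄₃ (c y)) ≤ ∑[ y ∈ elems n ] 4 * c y
    tight = begin
      ∑[ y ∈ elems n ] (c y * c y + w₃₄₃ (c y)) ≡⟨ ∑-k²+w₃₄₃ ⟩
      Npairs f + M₃₄₃                            ≡⟨ cong (Npairs f +_) M≡ ⟩
      Npairs f + (2 ^ n + 2)                     ≡⟨ x∙yz≈xz∙y (Npairs f) (2 ^ n) 2 ⟩
      Npairs f + 2 + 2 ^ n
        ≡⟨ cong (_+ 2 ^ n) (M₃₄₃≡2ⁿ+2⇒Npairs+2≡3·2ⁿ apn M≡) ⟩
      3 * 2 ^ n + 2 ^ n                          ≡⟨ +-comm (3 * 2 ^ n) (2 ^ n) ⟩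
      4 * 2 ^ n                                  ≡⟨ ∑-scaled-preimCount 4 ⟨
      ∑[ y ∈ elems n ] 4 * c y                   ∎

  preimCount≤4⇒M₃₄₃≡2ⁿ+2 : Npairs f + 2 ≡ 3 * 2 ^ n → (∀ y → c y ≤ 4) → M₃₄₃ ≡ 2 ^ n + 2
  preimCount≤4⇒M₃₄₃≡2ⁿ+2 N+2≡3·2ⁿ c≤4 = +-cancelˡ-≡ (Npairs f) _ _ (begin
    Npairs f + M₃₄₃                            ≡⟨ ∑-k²+w₃₄₃ ⟨
    ∑[ y ∈ elems n ] (c y * c y + w₃₄₃ (c y)) ≡⟨ ∑-cong (elems n) (k≤4⇒k²+w₃₄₃≡4k ∘ c≤4) ⟩
    ∑[ y ∈ elems n ] 4 * c y                   ≡⟨ ∑-scaled-preimCount 4 ⟩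
    4 * 2 ^ n                                  ≡⟨ +-comm (3 * 2 ^ n) (2 ^ n) ⟨
    3 * 2 ^ n + 2 ^ n                          ≡⟨ cong (_+ 2 ^ n) N+2≡3·2ⁿ ⟨
    Npairs f + 2 + 2 ^ n                       ≡⟨ x∙yz≈xz∙y (Npairs f) (2 ^ n) 2 ⟨
    Npairs f + (2 ^ n + 2)                     ∎)
    where open ≡-Reasoning

  M₃₄₃≡2ⁿ+2⇔ : APN f → (M₃₄₃ ≡ 2 ^ n + 2 ⇔ (Npairs f + 2 ≡ 3 * 2 ^ n × (∀ y → c y ≤ 4)))
  M₃₄₃≡2ⁿ+2⇔ apn = mk⇔
    (λ M≡ → M₃₄₃≡2ⁿ+2⇒Npairs+2≡3·2ⁿ apn M≡ , M₃₄₃≡2ⁿ+2⇒preimCount≤4 apn M≡)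
    (uncurry preimCount≤4⇒M₃₄₃≡2ⁿ+2)

  M₁+M₂≡2M₄+1 : Npairs f + 2 ≡ 3 * 2 ^ n → (∀ y → c y ≤ 4) → M 1 f + M 2 f ≡ 2 * M 4 f + 1
  M₁+M₂≡2M₄+1 N+2≡3·2ⁿ c≤4 = *-cancelˡ-≡ _ _ 2 (+-cancelˡ-≡ (Npairs f) _ _ (begin
    Npairs f + 2 * (M 1 f + M 2 f)                  ≡⟨ ∑-k²+2δ₁₂ ⟨
    ∑[ y ∈ elems n ] (c y * c y + 2 * δ₁₂ (c y))
      ≡⟨ ∑-cong (elems n) (k≤4⇒k²+2δ₁₂≡3k+4δ₄ ∘ c≤4) ⟩
    ∑[ y ∈ elems n ] (3 * c y + 4 * δ 4 (c y))      ≡⟨ ∑-+ (elems n) _ _ ⟩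
    (∑[ y ∈ elems n ] 3 * c y) + (∑[ y ∈ elems n ] 4 * δ 4 (c y))
      ≡⟨ cong₂ _+_ (∑-scaled-preimCount 3) (∑-scaled-δ 4 4) ⟩
    3 * 2 ^ n + 4 * M 4 f                           ≡⟨ cong (_+ 4 * M 4 f) N+2≡3·2ⁿ ⟨
    Npairs f + 2 + 4 * M 4 f                        ≡⟨ a+2+4m≡a+2[2m+1] (Npairs f) (M 4 f) ⟩
    Npairs f + 2 * (2 * M 4 f + 1)                  ∎))
    where
    open ≡-Reasoning
    a+2+4m≡a+2[2m+1] : ∀ a m → a + 2 + 4 * m ≡ a + 2 * (2 * m + 1)
    a+2+4m≡a+2[2m+1] = solve-∀

  preimCount≤⇔M≡0 : ∀ m → (∀ y → c y ≤ m) ⇔ (∀ r → m < r → M r f ≡ 0)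
  preimCount≤⇔M≡0 m = mk⇔ to from
    where
    to : (∀ y → c y ≤ m) → ∀ r → m < r → M r f ≡ 0
    to c≤m r m<r = trans (M≡∑δ r) (∑-zero (elems n) (λ {y} _ →
      𝟙-no (c y ≟ r) (<⇒≢ (≤-<-trans (c≤m y) m<r))))
    from : (∀ r → m < r → M r f ≡ 0) → ∀ y → c y ≤ m
    from M≡0 y = ≮⇒≥ (λ m<cy → 1+n≢0 (begin
      1             ≡⟨ 𝟙-yes (c y ≟ c y) refl ⟨
      δ (c y) (c y) ≡⟨ ∑≡0⇒ (elems n) (trans (sym (M≡∑δ (c y))) (M≡0 (c y) m<cy)) (elems-complete n y) ⟩
      0             ∎))
      where open ≡-Reasoning

-- The statement also holds for n = 0.
corollary4p1 : (n : ℕ) → 1 ≤ n → (f : F n → F n) → APN f →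
    (1 ≤ M 1 f + M 2 f
      × (Even n → (M 1 f + M 2 f ≡ 1 ⇔ Almost3to1 f))
      × (Odd n → (M 1 f + M 2 f ≡ 1 ⇔ UniqueKRest3 2 f)))
    × (2 ^ n + 2 ≤ 3 * M 1 f + 4 * M 2 f + 3 * M 3 f
      × (3 * M 1 f + 4 * M 2 f + 3 * M 3 f ≡ 2 ^ n + 2
          ⇔ (Npairs f ≡ 3 * 2 ^ n ∸ 2 × (∀ (r : ℕ) → 4 < r → M r f ≡ 0)))
      × (3 * M 1 f + 4 * M 2 f + 3 * M 3 f ≡ 2 ^ n + 2 → M 1 f + M 2 f ≡ 2 * M 4 f + 1))
corollary4p1 n _ f apn =
  ( M₁+M₂≥1 apn
  , (λ n-even → mk⇔ (subst (λ k → UniqueKRest3 k f) (Even⇒2^n%3≡1 n-even) ∘ M₁+M₂≡1⇒UniqueKRest3 apn)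
                    (UniqueKRest3⇒M₁+M₂≡1 refl))
  , (λ n-odd → mk⇔ (subst (λ k → UniqueKRest3 k f) (Odd⇒2^n%3≡2 n-odd) ∘ M₁+M₂≡1⇒UniqueKRest3 apn)
                   (UniqueKRest3⇒M₁+M₂≡1 refl)) )
  , ( 2ⁿ+2≤M₃₄₃ apn
    , ⇔.trans (M₃₄₃≡2ⁿ+2⇔ apn) (⇔.sym (m≡n∸o⇔m+o≡n 2≤3·2ⁿ) ×-⇔ preimCount≤⇔M≡0 4)
    , uncurry M₁+M₂≡2M₄+1 ∘ Equivalence.to (M₃₄₃≡2ⁿ+2⇔ apn) )
  where
  open PreimageCounts f
  2≤3·2ⁿ : 2 ≤ 3 * 2 ^ n
  2≤3·2ⁿ = ≤-trans (n≤1+n 2) (*-monoʳ-≤ 3 (m^n>0 2 n))
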